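{- Let $k\ge 3$ be an integer and let $S$ be a set of integers containing no arithmetic progression of length $k$. Let $c$ be a real number with $1<c<\frac{k}{k-1}$. Let $d\ge 1$, let $a_0$ be an integer and let $a_1,\ldots,a_d$ be positive integers such that \[ H = a_0+\{0,a_1\}+\cdots+\{0,a_d\} = \Big\{ a_0+\sum_{i=1}^d \epsilon_i a_i : \epsilon_i\in\{0,1\}\Big\} \subseteq S. \] Then $|H|\ge 2c^{d-1}$.
   Context: An arithmetic progression of length $k$ is a set $\{b, b+h, \ldots, b+(k-1)h\}$ with $b,h$ integers and $h\neq 0$. $|H|$ denotes the number of distinct elements of the set $H$.
   Formalization: The number c with $1<c<\frac{k}{k-1}$ is taken to be rational rather than an arbitrary real number. -}

module Defs where

open import Data.Nat using (ℕ; zero; suc)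
open import Data.Integer using (ℤ; +_; _+_; _*_)
open import Relation.Binary.PropositionalEquality using (_≢_)
open import Data.Integer.Properties using (_≟_)
open import Data.List using (List; []; _∷_; _++_; map; length; deduplicate)
open import Data.Vec using (Vec; []; _∷_)
open import Data.Product using (∃₂; _×_)
open import Data.Rational as ℚ using (ℚ; 1ℚ)
open import Relation.Nullary using (¬_)

NoAP : ℕ → (ℤ → Set) → Set
NoAP k S = ¬ (∃₂ λ (b : ℤ) (h : ℤ) → (h ≢ + 0) × ((i : ℕ) → i Data.Nat.< k → S (b + (+ i) * h)))

subsetSums : ∀ {d} → Vec ℤ d → List ℤ
subsetSums [] = + 0 ∷ []
subsetSums (a ∷ as) = subsetSums as ++ map (λ x → a + x) (subsetSums as)

Hlist : ∀ {d} → ℤ → Vec ℤ d → List ℤ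
Hlist a0 as = map (λ x → a0 + x) (subsetSums as)

card : List ℤ → ℕ
card l = length (deduplicate _≟_ l)

_^ℚ_ : ℚ → ℕ → ℚ
q ^ℚ zero = 1ℚ
q ^ℚ suc n = q ℚ.* (q ^ℚ n)

ℕ→ℚ : ℕ → ℚ
ℕ→ℚ n = (+ n) ℚ./ 1

{-# OPTIONS --safe #-}
-- Let B_i = a0 + {0,a_1} + ... + {0,a_i}.  Then B_{i-1} ⊆ B_i and B_{i-1} + a_i ⊆ B_i.
-- Starting from any y ∈ B_i, the points y, y + a_i, ..., y + (k-1) a_i cannot all lie
-- in B_i ⊆ S, so one of the first k-1 of them lies in B_i ∖ B_{i-1} (otherwise adding
-- a_i keeps the walk inside B_i).  Hence B_i is covered by k-1 translates of
-- B_i ∖ B_{i-1}, which gives (k-2)|B_i| ≥ (k-1)|B_{i-1}|, and |B_i| ≥ c |B_{i-1}|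
-- for every c ≤ (k-1)/(k-2), in particular for 1 < c < k/(k-1).  Iterating from
-- |B_1| = 2 gives |H| ≥ 2 c^(d-1).
module Submission where

open import Defs
open import Data.Nat using (ℕ; _≥_; _∸_)
open import Data.Integer using (ℤ; +_; _<_)
open import Data.Vec using (Vec)
open import Data.Vec.Relation.Unary.All using (All)
open import Data.List.Relation.Unary.All as L using ()
open import Data.Rational as ℚ using (ℚ; 1ℚ)

open import Data.Nat as ℕ using (zero; suc; z≤n; s≤s; NonZero)
import Data.Nat.Properties as ℕP
import Data.Nat.Coprimality as Coprime
open import Data.Integer as ℤ using (_+_; _-_; _*_)
import Data.Integer.Properties as ℤP
open import Data.Integer.Tactic.RingSolver using (solve-∀)
open import Data.Rational as ℚ using (mkℚ; toℚᵘ)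
import Data.Rational.Properties as ℚP
import Data.Rational.Unnormalised as ℚᵘ
import Data.Rational.Unnormalised.Properties as ℚᵘP
open import Data.Vec using ([]; _∷_)
import Data.Vec.Relation.Unary.All as Vec
open import Data.List using (List; []; _∷_; _++_; map; length; filter)
import Data.List.Properties as ListP
open import Data.List.Membership.Propositional using (_∈_)
open import Data.List.Membership.Propositional.Properties
  using (∈-filter⁺; ∈-filter⁻; ∈-++⁺ˡ; ∈-++⁺ʳ; ∈-++⁻; ∈-map⁺; ∈-map⁻; ∈-deduplicate⁺; ∈-deduplicate⁻)
open import Data.List.Membership.DecPropositional ℤP._≟_ using (_∈?_)
open import Data.List.Relation.Binary.Subset.Propositional using (_⊆_)
open import Data.List.Relation.Unary.Any as Any using (here; there)
import Data.List.Relation.Unary.All as List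
open import Data.List.Relation.Unary.AllPairs using ([]; _∷_)
open import Data.List.Relation.Unary.Unique.Propositional using (Unique)
open import Data.List.Relation.Unary.Unique.Propositional.Properties using (++⁺; filter⁺)
open import Data.List.Relation.Unary.Unique.DecPropositional.Properties ℤP._≟_ using (deduplicate-!)
open import Data.Product using (∃-syntax; _×_; _,_; proj₁; proj₂)
open import Data.Sum using (_⊎_; inj₁; inj₂)
open import Data.Empty using (⊥-elim)
open import Relation.Binary.Definitions using (DecidableEquality)
open import Relation.Binary.PropositionalEquality
open import Relation.Nullary using (¬_; ¬?; yes; no)

Unique⇒length≤ : ∀ {a} {A : Set a} → DecidableEquality A →
                 ∀ {xs ys : List A} → Unique xs → xs ⊆ ys → length xs ℕ.≤ length ys
Unique⇒length≤ _≟_ {[]} _ _ = z≤n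
Unique⇒length≤ _≟_ {x ∷ xs} {ys} (x∉xs ∷ xs!) x∷xs⊆ys = begin
  suc (length xs)                         ≤⟨ s≤s (Unique⇒length≤ _≟_ xs! xs⊆ys-x) ⟩
  suc (length (filter ≢x? ys))            ≤⟨ ListP.filter-notAll ≢x? ys x∈ys ⟩
  length ys                               ∎
  where
  open ℕP.≤-Reasoning
  ≢x? = λ y → ¬? (y ≟ x)
  xs⊆ys-x : xs ⊆ filter ≢x? ys
  xs⊆ys-x z∈xs = ∈-filter⁺ ≢x? (x∷xs⊆ys (there z∈xs)) (λ z≡x → List.lookup x∉xs z∈xs (sym z≡x))
  x∈ys = Any.map (λ x≡y y≢x → y≢x (sym x≡y)) (x∷xs⊆ys (here refl))

below-snoc : ∀ {p} {P : ℕ → Set p} {n} → (∀ i → i ℕ.< n → P i) → P n → ∀ i → i ℕ.< suc n → P i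
below-snoc {n = n} below Pn i i<1+n with ℕP.m<1+n⇒m<n∨m≡n i<1+n
... | inj₁ i<n  = below i i<n
... | inj₂ refl = Pn

module _ {m : ℕ} {S : ℤ → Set} (noAP : NoAP (suc m) S)
         {a : ℤ} (a≢0 : a ≢ + 0) {A B : List ℤ}
         (B⊆S : ∀ {x} → x ∈ B → S x) (A⊆B : A ⊆ B) (A+a⊆B : ∀ {x} → x ∈ A → x + a ∈ B) where

  B∖A : List ℤ
  B∖A = filter (λ x → ¬? (x ∈? A)) B

  hits-B∖A⊎stays-in-B : ∀ n {y} → y ∈ B →
         (∃[ j ] j ℕ.< n × y + + j * a ∈ B∖A) ⊎ (∀ i → i ℕ.< suc n → y + + i * a ∈ B)
  hits-B∖A⊎stays-in-B zero {y} y∈B = inj₂ λ { zero _ → subst (_∈ B) (y≡y+0a y a) y∈B ; (suc i) (s≤s ()) }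
    where
    y≡y+0a : ∀ y a → y ≡ y + + 0 * a
    y≡y+0a = solve-∀
  hits-B∖A⊎stays-in-B (suc n) {y} y∈B with hits-B∖A⊎stays-in-B n y∈B
  ... | inj₁ (j , j<n , y+ja∈B∖A) = inj₁ (j , ℕP.m<n⇒m<1+n j<n , y+ja∈B∖A)
  ... | inj₂ inB with y + + n * a ∈? A
  ...   | no  ∉A = inj₁ (n , ℕP.n<1+n n , ∈-filter⁺ _ (inB n (ℕP.n<1+n n)) ∉A)
  ...   | yes ∈A = inj₂ (below-snoc inB (subst (_∈ B) (+-*-suc y (+ n) a) (A+a⊆B ∈A)))
    where
    +-*-suc : ∀ y t a → y + t * a + a ≡ y + (+ 1 + t) * a
    +-*-suc = solve-∀

  translates : ℕ → List ℤ
  translates zero    = []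
  translates (suc n) = map (λ z → z - + n * a) B∖A ++ translates n

  length-translates : ∀ n → length (translates n) ≡ n ℕ.* length B∖A
  length-translates zero    = refl
  length-translates (suc n) = begin
    length (map (λ z → z - + n * a) B∖A ++ translates n)
      ≡⟨ ListP.length-++ (map _ B∖A) ⟩
    length (map (λ z → z - + n * a) B∖A) ℕ.+ length (translates n)
      ≡⟨ cong₂ ℕ._+_ (ListP.length-map _ B∖A) (length-translates n) ⟩
    length B∖A ℕ.+ n ℕ.* length B∖A
      ∎
    where open ≡-Reasoning

  ∈-translates : ∀ n {j w} → j ℕ.< n → w ∈ B∖A → w - + j * a ∈ translates n
  ∈-translates (suc n) {j} j<1+n w∈ with ℕP.m<1+n⇒m<n∨m≡n j<1+n
  ... | inj₁ j<n  = ∈-++⁺ʳ (map _ B∖A) (∈-translates n j<n w∈)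
  ... | inj₂ refl = ∈-++⁺ˡ (∈-map⁺ (λ z → z - + j * a) w∈)

  B⊆translates : B ⊆ translates m
  B⊆translates {y} y∈B with hits-B∖A⊎stays-in-B m y∈B
  ... | inj₂ inB = ⊥-elim (noAP (y , a , a≢0 , λ i i<k → B⊆S (inB i i<k)))
  ... | inj₁ (j , j<m , y+ja∈B∖A) =
    subst (_∈ translates m) (+-cancelʳ y (+ j * a)) (∈-translates m j<m y+ja∈B∖A)
    where
    +-cancelʳ : ∀ y t → y + t - t ≡ y
    +-cancelʳ = solve-∀

  A++B∖A⊆B : A ++ B∖A ⊆ B
  A++B∖A⊆B x∈ with ∈-++⁻ A x∈
  ... | inj₁ x∈A   = A⊆B x∈A
  ... | inj₂ x∈B∖A = proj₁ (∈-filter⁻ _ {xs = B} x∈B∖A)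

  noAP⇒length-growth : Unique A → Unique B → m ℕ.* length A ℕ.+ length B ℕ.≤ m ℕ.* length B
  noAP⇒length-growth A! B! = begin
    m ℕ.* length A ℕ.+ length B           ≤⟨ ℕP.+-monoʳ-≤ (m ℕ.* length A) B≤m*B∖A ⟩
    m ℕ.* length A ℕ.+ m ℕ.* length B∖A   ≡⟨ ℕP.*-distribˡ-+ m (length A) (length B∖A) ⟨
    m ℕ.* (length A ℕ.+ length B∖A)       ≤⟨ ℕP.*-monoʳ-≤ m A+B∖A≤B ⟩
    m ℕ.* length B                        ∎
    where
    open ℕP.≤-Reasoning
    B≤m*B∖A : length B ℕ.≤ m ℕ.* length B∖A
    B≤m*B∖A = subst (length B ℕ.≤_) (length-translates m) (Unique⇒length≤ ℤP._≟_ B! B⊆translates)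
    A+B∖A≤B : length A ℕ.+ length B∖A ℕ.≤ length B
    A+B∖A≤B = subst (ℕ._≤ length B) (ListP.length-++ A)
      (Unique⇒length≤ ℤP._≟_ (++⁺ A! (filter⁺ _ B!) disjoint) A++B∖A⊆B)
      where
      disjoint : ∀ {x} → ¬ (x ∈ A × x ∈ B∖A)
      disjoint (x∈A , x∈B∖A) = proj₂ (∈-filter⁻ _ {xs = B} x∈B∖A) x∈A

module _ (a0 : ℤ) {d : ℕ} (a : ℤ) (as : Vec ℤ d) where

  Hlist-⊆-∷ : Hlist a0 as ⊆ Hlist a0 (a ∷ as)
  Hlist-⊆-∷ x∈ with ∈-map⁻ (λ x → a0 + x) x∈
  ... | s , s∈ , refl = ∈-map⁺ (λ x → a0 + x) (∈-++⁺ˡ s∈)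

  Hlist-+-⊆-∷ : ∀ {x} → x ∈ Hlist a0 as → x + a ∈ Hlist a0 (a ∷ as)
  Hlist-+-⊆-∷ x∈ with ∈-map⁻ (λ x → a0 + x) x∈
  ... | s , s∈ , refl = subst (_∈ Hlist a0 (a ∷ as)) (+-comm-assoc a0 a s)
    (∈-map⁺ (λ x → a0 + x) (∈-++⁺ʳ (subsetSums as) (∈-map⁺ (λ x → a + x) s∈)))
    where
    +-comm-assoc : ∀ x y z → x + (y + z) ≡ x + z + y
    +-comm-assoc = solve-∀

  card-growth : ∀ {m S} → NoAP (suc m) S → a ≢ + 0 → L.All S (Hlist a0 (a ∷ as)) →
                m ℕ.* card (Hlist a0 as) ℕ.+ card (Hlist a0 (a ∷ as)) ℕ.≤ m ℕ.* card (Hlist a0 (a ∷ as))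
  card-growth noAP a≢0 H⊆S = noAP⇒length-growth noAP a≢0
    (λ x∈ → List.lookup H⊆S (∈-deduplicate⁻ ℤP._≟_ _ x∈))
    (λ x∈ → ∈-deduplicate⁺ ℤP._≟_ (Hlist-⊆-∷ (∈-deduplicate⁻ ℤP._≟_ _ x∈)))
    (λ x∈ → ∈-deduplicate⁺ ℤP._≟_ (Hlist-+-⊆-∷ (∈-deduplicate⁻ ℤP._≟_ _ x∈)))
    (deduplicate-! _) (deduplicate-! _)

2≤card-Hlist-[a] : ∀ a0 {a} → a ≢ + 0 → 2 ℕ.≤ card (Hlist a0 (a ∷ []))
2≤card-Hlist-[a] a0 {a} a≢0 = Unique⇒length≤ ℤP._≟_ ((a0+0≢a0+a List.∷ List.[]) ∷ List.[] ∷ [])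
  (∈-deduplicate⁺ ℤP._≟_)
  where
  a0+0≢a0+a : a0 + + 0 ≢ a0 + (a + + 0)
  a0+0≢a0+a eq = a≢0 (begin
    a                                ≡⟨ difference a0 a ⟩
    a0 + (a + + 0) - (a0 + + 0)      ≡⟨ cong (_- (a0 + + 0)) eq ⟨
    a0 + + 0 - (a0 + + 0)            ≡⟨ ℤP.+-inverseʳ (a0 + + 0) ⟩
    + 0                              ∎)
    where
    open ≡-Reasoning
    difference : ∀ x y → y ≡ x + (y + + 0) - (x + + 0)
    difference = solve-∀

ℕ→ℚ≡mkℚ : ∀ n → ℕ→ℚ n ≡ mkℚ (+ n) 0 (Coprime.sym (Coprime.1-coprimeTo n))
ℕ→ℚ≡mkℚ n = ℚP.normalize-coprime (Coprime.sym (Coprime.1-coprimeTo n))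

toℚᵘ-ℕ→ℚ : ∀ n → toℚᵘ (ℕ→ℚ n) ≡ ℚᵘ.mkℚᵘ (+ n) 0
toℚᵘ-ℕ→ℚ n = cong toℚᵘ (ℕ→ℚ≡mkℚ n)

ℕ→ℚ-+ : ∀ m n → ℕ→ℚ (m ℕ.+ n) ≡ ℕ→ℚ m ℚ.+ ℕ→ℚ n
ℕ→ℚ-+ m n = ℚP.toℚᵘ-injective (begin
  toℚᵘ (ℕ→ℚ (m ℕ.+ n))                          ≡⟨ toℚᵘ-ℕ→ℚ (m ℕ.+ n) ⟩
  ℚᵘ.mkℚᵘ (+ (m ℕ.+ n)) 0                       ≡⟨ cong (λ i → ℚᵘ.mkℚᵘ i 0) (trans (ℤP.pos-+ m n) (*1+*1 (+ m) (+ n))) ⟩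
  ℚᵘ.mkℚᵘ (+ m) 0 ℚᵘ.+ ℚᵘ.mkℚᵘ (+ n) 0          ≡⟨ cong₂ ℚᵘ._+_ (toℚᵘ-ℕ→ℚ m) (toℚᵘ-ℕ→ℚ n) ⟨
  toℚᵘ (ℕ→ℚ m) ℚᵘ.+ toℚᵘ (ℕ→ℚ n)                ≈⟨ ℚP.toℚᵘ-homo-+ (ℕ→ℚ m) (ℕ→ℚ n) ⟨
  toℚᵘ (ℕ→ℚ m ℚ.+ ℕ→ℚ n)                        ∎)
  where
  open ℚᵘP.≃-Reasoning
  *1+*1 : ∀ x y → x + y ≡ x * + 1 + y * + 1
  *1+*1 = solve-∀

ℕ→ℚ-* : ∀ m n → ℕ→ℚ (m ℕ.* n) ≡ ℕ→ℚ m ℚ.* ℕ→ℚ n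
ℕ→ℚ-* m n = ℚP.toℚᵘ-injective (begin
  toℚᵘ (ℕ→ℚ (m ℕ.* n))                          ≡⟨ toℚᵘ-ℕ→ℚ (m ℕ.* n) ⟩
  ℚᵘ.mkℚᵘ (+ (m ℕ.* n)) 0                       ≡⟨ cong (λ i → ℚᵘ.mkℚᵘ i 0) (ℤP.pos-* m n) ⟩
  ℚᵘ.mkℚᵘ (+ m) 0 ℚᵘ.* ℚᵘ.mkℚᵘ (+ n) 0          ≡⟨ cong₂ ℚᵘ._*_ (toℚᵘ-ℕ→ℚ m) (toℚᵘ-ℕ→ℚ n) ⟨
  toℚᵘ (ℕ→ℚ m) ℚᵘ.* toℚᵘ (ℕ→ℚ n)                ≈⟨ ℚP.toℚᵘ-homo-* (ℕ→ℚ m) (ℕ→ℚ n) ⟨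
  toℚᵘ (ℕ→ℚ m ℚ.* ℕ→ℚ n)                        ∎)
  where open ℚᵘP.≃-Reasoning

ℕ→ℚ-mono-≤ : ∀ {m n} → m ℕ.≤ n → ℕ→ℚ m ℚ.≤ ℕ→ℚ n
ℕ→ℚ-mono-≤ {m} {n} m≤n rewrite ℕ→ℚ≡mkℚ m | ℕ→ℚ≡mkℚ n =
  ℚ.*≤* (ℤP.*-monoʳ-≤-nonNeg (+ 1) (ℤ.+≤+ m≤n))

c*m≤1+m : ∀ {c} m → 1ℚ ℚ.< c → c ℚ.* ℕ→ℚ (suc m) ℚ.< ℕ→ℚ (suc (suc m)) →
          c ℚ.* ℕ→ℚ m ℚ.≤ ℕ→ℚ (suc m)
c*m≤1+m {c} m 1<c c[1+m]<2+m with c ℚ.* ℕ→ℚ m ℚP.≤? ℕ→ℚ (suc m)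
... | yes le = le
... | no  c*m≰1+m = ⊥-elim (ℚP.<-asym c[1+m]<2+m (begin-strict
  ℕ→ℚ (suc (suc m))               ≡⟨ ℕ→ℚ-+ 1 (suc m) ⟩
  1ℚ ℚ.+ ℕ→ℚ (suc m)              <⟨ ℚP.+-mono-< 1<c (ℚP.≰⇒> c*m≰1+m) ⟩
  c ℚ.+ c ℚ.* ℕ→ℚ m               ≡⟨ cong (ℚ._+ c ℚ.* ℕ→ℚ m) (ℚP.*-identityʳ c) ⟨
  c ℚ.* 1ℚ ℚ.+ c ℚ.* ℕ→ℚ m        ≡⟨ ℚP.*-distribˡ-+ c 1ℚ (ℕ→ℚ m) ⟨
  c ℚ.* (1ℚ ℚ.+ ℕ→ℚ m)            ≡⟨ cong (c ℚ.*_) (ℕ→ℚ-+ 1 m) ⟨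
  c ℚ.* ℕ→ℚ (suc m)               ∎))
  where open ℚP.≤-Reasoning

[1+m]p+q≤[1+m]q⇒[1+m]p≤mq : ∀ m p q → suc m ℕ.* p ℕ.+ q ℕ.≤ suc m ℕ.* q → suc m ℕ.* p ℕ.≤ m ℕ.* q
[1+m]p+q≤[1+m]q⇒[1+m]p≤mq m p q le =
  ℕP.+-cancelˡ-≤ q _ _ (subst (ℕ._≤ q ℕ.+ m ℕ.* q) (ℕP.+-comm (suc m ℕ.* p) q) le)

c*p≤q : ∀ {c} m .{{_ : NonZero m}} → c ℚ.* ℕ→ℚ m ℚ.≤ ℕ→ℚ (suc m) →
        ∀ {p q} → suc m ℕ.* p ℕ.≤ m ℕ.* q → c ℚ.* ℕ→ℚ p ℚ.≤ ℕ→ℚ q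
c*p≤q {c} m c*m≤1+m {p} {q} [1+m]p≤mq = ℚP.*-cancelˡ-≤-pos (ℕ→ℚ m) {{m>0}} (begin
  ℕ→ℚ m ℚ.* (c ℚ.* ℕ→ℚ p)         ≡⟨ ℚP.*-assoc (ℕ→ℚ m) c (ℕ→ℚ p) ⟨
  ℕ→ℚ m ℚ.* c ℚ.* ℕ→ℚ p           ≡⟨ cong (ℚ._* ℕ→ℚ p) (ℚP.*-comm (ℕ→ℚ m) c) ⟩
  c ℚ.* ℕ→ℚ m ℚ.* ℕ→ℚ p           ≤⟨ ℚP.*-monoʳ-≤-nonNeg (ℕ→ℚ p) {{p≥0}} c*m≤1+m ⟩
  ℕ→ℚ (suc m) ℚ.* ℕ→ℚ p           ≡⟨ ℕ→ℚ-* (suc m) p ⟨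
  ℕ→ℚ (suc m ℕ.* p)               ≤⟨ ℕ→ℚ-mono-≤ [1+m]p≤mq ⟩
  ℕ→ℚ (m ℕ.* q)                   ≡⟨ ℕ→ℚ-* m q ⟩
  ℕ→ℚ m ℚ.* ℕ→ℚ q                 ∎)
  where
  open ℚP.≤-Reasoning
  m>0 = ℚ.positive (ℚP.<-≤-trans (ℚP.positive⁻¹ 1ℚ) (ℕ→ℚ-mono-≤ (ℕ.>-nonZero⁻¹ m)))
  p≥0 = ℚ.nonNegative (ℕ→ℚ-mono-≤ (z≤n {p}))

module _ {m : ℕ} .{{_ : NonZero m}} {S : ℤ → Set} (noAP : NoAP (suc (suc m)) S)
         {c : ℚ} .{{_ : ℚ.NonNegative c}} (c*m≤1+m : c ℚ.* ℕ→ℚ m ℚ.≤ ℕ→ℚ (suc m)) (a0 : ℤ) where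

  2*c^d≤card-Hlist : ∀ {d} a (as : Vec ℤ d) → All (_≢ + 0) (a ∷ as) → L.All S (Hlist a0 (a ∷ as)) →
                     ℕ→ℚ 2 ℚ.* (c ^ℚ d) ℚ.≤ ℕ→ℚ (card (Hlist a0 (a ∷ as)))
  2*c^d≤card-Hlist a [] (a≢0 Vec.∷ _) _ = begin
    ℕ→ℚ 2 ℚ.* 1ℚ                          ≡⟨ ℚP.*-identityʳ (ℕ→ℚ 2) ⟩
    ℕ→ℚ 2                                 ≤⟨ ℕ→ℚ-mono-≤ (2≤card-Hlist-[a] a0 a≢0) ⟩
    ℕ→ℚ (card (Hlist a0 (a ∷ [])))        ∎
    where open ℚP.≤-Reasoning
  2*c^d≤card-Hlist {suc d} a (b ∷ as) (a≢0 Vec.∷ b∷as≢0) H⊆S = begin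
    ℕ→ℚ 2 ℚ.* (c ℚ.* c ^ℚ d)              ≡⟨ ℚP.*-assoc (ℕ→ℚ 2) c (c ^ℚ d) ⟨
    ℕ→ℚ 2 ℚ.* c ℚ.* c ^ℚ d                ≡⟨ cong (ℚ._* c ^ℚ d) (ℚP.*-comm (ℕ→ℚ 2) c) ⟩
    c ℚ.* ℕ→ℚ 2 ℚ.* c ^ℚ d                ≡⟨ ℚP.*-assoc c (ℕ→ℚ 2) (c ^ℚ d) ⟩
    c ℚ.* (ℕ→ℚ 2 ℚ.* c ^ℚ d)              ≤⟨ ℚP.*-monoˡ-≤-nonNeg c IH ⟩
    c ℚ.* ℕ→ℚ (card (Hlist a0 (b ∷ as)))  ≤⟨ c*p≤q {c} m c*m≤1+m growth ⟩
    ℕ→ℚ (card (Hlist a0 (a ∷ b ∷ as)))    ∎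
    where
    open ℚP.≤-Reasoning
    growth = [1+m]p+q≤[1+m]q⇒[1+m]p≤mq m _ _ (card-growth a0 a (b ∷ as) noAP a≢0 H⊆S)
    IH = 2*c^d≤card-Hlist b as b∷as≢0 (List.tabulate (λ x∈ → List.lookup H⊆S (Hlist-⊆-∷ a0 a (b ∷ as) x∈)))

lemma4 : (k : ℕ) → k ≥ 3 → (S : ℤ → Set) → NoAP k S →
         (c : ℚ) → 1ℚ ℚ.< c → c ℚ.* ℕ→ℚ (k ∸ 1) ℚ.< ℕ→ℚ k →
         (d : ℕ) → d ≥ 1 → (a0 : ℤ) → (as : Vec ℤ d) → All (λ a → + 0 < a) as →
         L.All S (Hlist a0 as) →
         ℕ→ℚ 2 ℚ.* (c ^ℚ (d ∸ 1)) ℚ.≤ ℕ→ℚ (card (Hlist a0 as))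
lemma4 (suc (suc (suc n))) (s≤s (s≤s (s≤s _))) S noAP c 1<c c[k-1]<k
       (suc d) (s≤s _) a0 (a ∷ as) as>0 H⊆S =
  2*c^d≤card-Hlist {m = suc n} noAP {{c≥0}} (c*m≤1+m (suc n) 1<c c[k-1]<k)
    a0 a as (Vec.map (λ 0<a → ≢-sym (ℤP.<⇒≢ 0<a)) as>0) H⊆S
  where c≥0 = ℚ.nonNegative (ℚP.<⇒≤ (ℚP.<-trans (ℚP.positive⁻¹ 1ℚ) 1<c))
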